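{- For every composition $\alpha\vDash n$, \[ \mathfrak{L}_{\alpha}^* = \sum_{\beta \vDash n} K^{\mathfrak{L}}_{\alpha, \beta} M_{\beta},\] and the transition matrix from $\{M_\beta\}_{\beta\vDash n}$ to $\{\mathfrak{L}^*_\alpha\}_{\alpha\vDash n}$ (coefficients $K^{\mathfrak{L}}_{\alpha,\beta}\ge 0$) is unitriangular when compositions are arranged in lexicographic order.
   Context: A composition $\alpha \vDash n$ is a tuple of positive integers summing to $n$; its diagram has left-justified rows, row $i$ (from the bottom) having $\alpha_i$ cells. A word is a necklace word if it is lexicographically weakly smallest among all its cyclic shifts. A lexical tableau of shape $\alpha$ is a filling of the diagram of $\alpha$ with positive integers such that the first column strictly increases from the bottom row upward and every row read left to right is a necklace word; its type is the tuple $(\beta_1,\beta_2,\dots)$ where $\beta_i$ is the number of entries equal to $i$. $K^{\mathfrak{L}}_{\alpha,\beta}$ is the number of lexical tableaux of shape $\alpha$ and type $\beta$. For a lexical tableau $T$, $x^T=\prod_i x_i^{\#\{\text{entries of }T\text{ equal to }i\}}$. The dual lexical function is $\mathfrak{L}^*_\alpha=\sum_{T} x^T$, summed over all lexical tableaux $T$ of shape $\alpha$. The monomial quasisymmetric function is $M_\beta=\sum_{i_1<\cdots<i_{\ell(\beta)}} x_{i_1}^{\beta_1}\cdots x_{i_{\ell(\beta)}}^{\beta_{\ell(\beta)}}$. The lexicographic order compares compositions at the first index where they differ. -}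

module Defs where

open import Data.Bool using (Bool; true; false; _∧_; _∨_; if_then_else_)
open import Data.Nat using (ℕ; zero; suc; _+_; _*_; _<_; _≡ᵇ_; _<ᵇ_; _≤ᵇ_)
open import Data.Nat.ListAction using (sum)
open import Data.List using (List; []; _∷_; length; map; concatMap; upTo;
  filterᵇ; foldr; _++_; take; drop; replicate)
open import Data.List.Relation.Unary.All using (All)
open import Data.List.Relation.Binary.Lex.Strict using (Lex-<)
open import Relation.Binary.PropositionalEquality using (_≡_)

_⊨_ : List ℕ → ℕ → Set
α ⊨ n = All (λ a → 0 < a) α × sum α ≡ n
  where open import Data.Product using (_×_)

_<lex_ : List ℕ → List ℕ → Set
_<lex_ = Lex-< _≡_ _<_

eqList : List ℕ → List ℕ → Bool
eqList []       []       = true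
eqList (x ∷ xs) (y ∷ ys) = (x ≡ᵇ y) ∧ eqList xs ys
eqList _        _        = false

allᵇ : {A : Set} → (A → Bool) → List A → Bool
allᵇ p = foldr (λ x b → p x ∧ b) true

words : ℕ → ℕ → List (List ℕ)
words k zero    = [] ∷ []
words k (suc m) = concatMap (λ a → map (suc a ∷_) (words k m)) (upTo k)

compositions : ℕ → List (List ℕ)
compositions n =
  filterᵇ (λ β → sum β ≡ᵇ n) (concatMap (words n) (upTo (suc n)))

-- all fillings of the diagram of α (rows listed from the bottom,
-- row i having α_i cells) with entries in {1,…,k}
fillings : ℕ → List ℕ → List (List (List ℕ))
fillings k []      = [] ∷ []
fillings k (a ∷ α) = concatMap (λ r → map (r ∷_) (fillings k α)) (words k a)

lexLeq : List ℕ → List ℕ → Bool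
lexLeq []       _        = true
lexLeq (x ∷ xs) []       = false
lexLeq (x ∷ xs) (y ∷ ys) = (x <ᵇ y) ∨ ((x ≡ᵇ y) ∧ lexLeq xs ys)

rotate : ℕ → List ℕ → List ℕ
rotate i w = drop i w ++ take i w

isNecklace : List ℕ → Bool
isNecklace w = allᵇ (λ i → lexLeq w (rotate i w)) (upTo (length w))

firstColIncreasing : List (List ℕ) → Bool
firstColIncreasing []                          = true
firstColIncreasing (r ∷ [])                    = true
firstColIncreasing ((a ∷ _) ∷ ((b ∷ r) ∷ rs))  =
  (a <ᵇ b) ∧ firstColIncreasing ((b ∷ r) ∷ rs)
firstColIncreasing _                           = false

isLexical : List (List ℕ) → Bool
isLexical T = firstColIncreasing T ∧ allᵇ isNecklace T

countIn : ℕ → List (List ℕ) → ℕ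
countIn i T = sum (map (λ r → length (filterᵇ (λ x → x ≡ᵇ i) r)) T)

content : ℕ → List (List ℕ) → List ℕ
content m T = map (λ i → countIn (suc i) T) (upTo m)

countLexical : List ℕ → List ℕ → ℕ
countLexical α γ =
  length (filterᵇ (λ T → isLexical T ∧ eqList (content (length γ) T) γ)
                  (fillings (length γ) α))

K : List ℕ → List ℕ → ℕ
K α β = countLexical α β

-- Formal power series in x_1, x_2, … are given by their coefficient
-- functions.  A monomial x_1^{γ_1} ⋯ x_m^{γ_m} is given by its exponent
-- list γ (trailing zeros are irrelevant for all coefficients below).

-- coefficient of x^γ in the dual lexical function 𝔏*_α = Σ_T x^T
coeffDualLexical : List ℕ → List ℕ → ℕ
coeffDualLexical α γ = countLexical α γ

nonzeros : List ℕ → List ℕ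
nonzeros = filterᵇ (λ x → 1 ≤ᵇ x)

-- coefficient of x^γ in M_β = Σ_{i_1<⋯<i_l} x_{i_1}^{β_1} ⋯ x_{i_l}^{β_l}
coeffM : List ℕ → List ℕ → ℕ
coeffM β γ = if eqList (nonzeros γ) β then 1 else 0

coeffSumM : ℕ → (List ℕ → ℕ) → List ℕ → ℕ
coeffSumM n c γ = sum (map (λ β → c β * coeffM β γ) (compositions n))

-- The coefficient of x^γ in 𝔏*_α counts the lexical tableaux of shape α and content γ.
-- Letters j with γ_j = 0 do not occur in such a tableau, and relabelling the remaining
-- letters by the increasing bijection from {1,…,ℓ} onto {j ∣ γ_j ≠ 0} preserves both the
-- necklace condition and the increasing first column, since both only compare letters.
-- Hence the coefficient is K_{α,β} for the composition β of nonzero entries of γ, which is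
-- the coefficient of x^γ in Σ_β K_{α,β} M_β.
--
-- For triangularity let T be lexical of shape α and content β. A necklace starts with its
-- smallest letter and the first column increases, so the smallest letter of T only occurs
-- in the bottom row: β_1 ≤ α_1, with equality only if the bottom row is constant. Induction
-- on the rows gives ¬ (α <lex β), and for α = β the unique T whose i-th row is constantly i.

module Submission where

open import Defs
open import Algebra.Properties.CommutativeSemigroup using (interchange)
open import Data.Bool using (Bool; true; false; _∧_; _∨_; if_then_else_; T?) renaming (T to True)
open import Data.Bool.Properties using (T-∧; T-∨)
open import Data.Empty using (⊥-elim)
open import Data.List using (List; []; _∷_; _++_; length; map; concatMap; upTo; applyUpTo; filterᵇ; replicate; take; drop)
open import Data.List.Properties using (filter-++; filter-none; filter-some; length-filter; length-++; length-map;
  length-replicate; map-++; map-∘; map-cong; map-upTo; drop-map; take-map; take++drop≡id;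
  ∷-injective; ∷-injectiveˡ; ∷-injectiveʳ)
open import Data.List.Membership.Propositional using (_∈_)
open import Data.List.Membership.Propositional.Properties using (∈-filter⁻; ∈-map⁺; ∈-upTo⁺)
open import Data.List.Relation.Binary.Lex.Core using (base; this; next)
open import Data.List.Relation.Unary.Any as Any using (here; there)
open import Data.List.Relation.Unary.All as All using (All; []; _∷_)
import Data.List.Relation.Unary.All.Properties as All
open import Data.Nat using (ℕ; zero; suc; _+_; _*_; _<_; _≤_; _≡ᵇ_; _<ᵇ_; z≤n; s≤s; z<s; s<s; s≤s⁻¹)
open import Data.Nat.ListAction using (sum)
open import Data.Nat.Properties
open import Data.Product using (_×_; _,_; proj₁; proj₂; ∃)
open import Data.Sum using (inj₂)
open import Function using (_∘_; id)
open import Function.Bundles using (Equivalence)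
open import Relation.Binary.Core using (_Preserves_⟶_)
open import Relation.Binary.Definitions using (tri<; tri≈; tri>)
open import Relation.Binary.PropositionalEquality
open import Relation.Nullary using (¬_; yes; no)

private variable
  A B : Set

∧-elim : ∀ {a b} → True (a ∧ b) → True a × True b
∧-elim = Equivalence.to T-∧

∧-intro : ∀ {a b} → True a → True b → True (a ∧ b)
∧-intro x y = Equivalence.from T-∧ (x , y)

True-injective : ∀ {a b} → (True a → True b) → (True b → True a) → a ≡ b
True-injective {false} {false} _ _ = refl
True-injective {false} {true}  _ b⇒a = ⊥-elim (b⇒a _)
True-injective {true}  {false} a⇒b _ = ⊥-elim (a⇒b _)
True-injective {true}  {true}  _ _ = refl

filterᵇ-map : (p : B → Bool) (f : A → B) (xs : List A) →
  filterᵇ p (map f xs) ≡ map f (filterᵇ (p ∘ f) xs)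
filterᵇ-map p f [] = refl
filterᵇ-map p f (x ∷ xs) with p (f x)
... | true  = cong (f x ∷_) (filterᵇ-map p f xs)
... | false = filterᵇ-map p f xs

filterᵇ-cong-∈ : {p q : A → Bool} (xs : List A) → (∀ {x} → x ∈ xs → p x ≡ q x) →
  filterᵇ p xs ≡ filterᵇ q xs
filterᵇ-cong-∈ [] _ = refl
filterᵇ-cong-∈ {p = p} {q} (x ∷ xs) p≡q with p x | q x | p≡q (here refl)
... | true  | true  | _ = cong (x ∷_) (filterᵇ-cong-∈ xs (p≡q ∘ there))
... | false | false | _ = filterᵇ-cong-∈ xs (p≡q ∘ there)

filterᵇ-filterᵇ : {p q : A → Bool} (xs : List A) → (∀ {x} → x ∈ xs → True (p x) → True (q x)) →
  filterᵇ p (filterᵇ q xs) ≡ filterᵇ p xs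
filterᵇ-filterᵇ [] _ = refl
filterᵇ-filterᵇ {p = p} {q} (x ∷ xs) p⇒q with q x | p⇒q (here refl)
... | true  | _ with p x
...   | true  = cong (x ∷_) (filterᵇ-filterᵇ xs (p⇒q ∘ there))
...   | false = filterᵇ-filterᵇ xs (p⇒q ∘ there)
filterᵇ-filterᵇ {p = p} {q} (x ∷ xs) p⇒q | false | p⇒q₀ with p x
...   | true  = ⊥-elim (p⇒q₀ _)
...   | false = filterᵇ-filterᵇ xs (p⇒q ∘ there)

filterᵇ-none : {p : A → Bool} (xs : List A) → (∀ {x} → x ∈ xs → ¬ True (p x)) → filterᵇ p xs ≡ []
filterᵇ-none {p = p} xs ¬p = filter-none (T? ∘ p) (All.tabulate ¬p)

filterᵇ-concatMap : (p : B → Bool) (f : A → List B) (xs : List A) →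
  filterᵇ p (concatMap f xs) ≡ concatMap (filterᵇ p ∘ f) xs
filterᵇ-concatMap p f [] = refl
filterᵇ-concatMap p f (x ∷ xs) = trans (filter-++ (T? ∘ p) (f x) (concatMap f xs))
  (cong (filterᵇ p (f x) ++_) (filterᵇ-concatMap p f xs))

length-concatMap : (f : A → List B) (xs : List A) → length (concatMap f xs) ≡ sum (map (length ∘ f) xs)
length-concatMap f [] = refl
length-concatMap f (x ∷ xs) = trans (length-++ (f x)) (cong (length (f x) +_) (length-concatMap f xs))

allᵇ-intro : {p : A → Bool} (xs : List A) → (∀ {x} → x ∈ xs → True (p x)) → True (allᵇ p xs)
allᵇ-intro []       _  = _
allᵇ-intro (x ∷ xs) px = ∧-intro (px (here refl)) (allᵇ-intro xs (px ∘ there))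

allᵇ-elim : {p : A → Bool} (xs : List A) → True (allᵇ p xs) → ∀ {x} → x ∈ xs → True (p x)
allᵇ-elim (y ∷ xs) h (here refl) = proj₁ (∧-elim h)
allᵇ-elim (y ∷ xs) h (there x∈) = allᵇ-elim xs (proj₂ (∧-elim h)) x∈

allᵇ-cong : {p q : A → Bool} → (∀ x → p x ≡ q x) → ∀ xs → allᵇ p xs ≡ allᵇ q xs
allᵇ-cong p≡q []       = refl
allᵇ-cong p≡q (x ∷ xs) = cong₂ _∧_ (p≡q x) (allᵇ-cong p≡q xs)

sum-map-if : (p : A → Bool) (c : ℕ) (xs : List A) →
  sum (map (λ x → if p x then c else 0) xs) ≡ c * length (filterᵇ p xs)
sum-map-if p c [] = sym (*-zeroʳ c)
sum-map-if p c (x ∷ xs) with p x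
... | true  = trans (cong (c +_) (sum-map-if p c xs)) (sym (*-suc c _))
... | false = sum-map-if p c xs

sum-map-+ : (f g : A → ℕ) (xs : List A) → sum (map (λ x → f x + g x) xs) ≡ sum (map f xs) + sum (map g xs)
sum-map-+ f g []       = refl
sum-map-+ f g (x ∷ xs) =
  trans (cong (f x + g x +_) (sum-map-+ f g xs)) (interchange +-commutativeSemigroup (f x) (g x) (sum (map f xs)) (sum (map g xs)))

sum-map-0 : (xs : List A) → sum (map (λ _ → 0) xs) ≡ 0
sum-map-0 []       = refl
sum-map-0 (x ∷ xs) = sum-map-0 xs

∈⇒≤sum : ∀ {n ns} → n ∈ ns → n ≤ sum ns
∈⇒≤sum {ns = n ∷ ns} (here refl) = m≤m+n n (sum ns)
∈⇒≤sum {ns = m ∷ ns} (there n∈) = ≤-trans (∈⇒≤sum n∈) (m≤n+m (sum ns) m)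

length≤sum : ∀ {β} → All (0 <_) β → length β ≤ sum β
length≤sum [] = z≤n
length≤sum (b>0 ∷ β>0) = +-mono-≤ b>0 (length≤sum β>0)

upTo-suc : ∀ n → upTo (suc n) ≡ 0 ∷ map suc (upTo n)
upTo-suc n = cong (0 ∷_) (sym (map-upTo suc n))

count-upTo : ∀ {a k} → a < k → length (filterᵇ (a ≡ᵇ_) (upTo k)) ≡ 1
count-upTo {a} {suc k} a<1+k = trans (cong (length ∘ filterᵇ (a ≡ᵇ_)) (upTo-suc k)) (count a a<1+k)
  where
  count : ∀ a → a < suc k → length (filterᵇ (a ≡ᵇ_) (0 ∷ map suc (upTo k))) ≡ 1
  count zero _ = cong (suc ∘ length)
    (trans (filterᵇ-map (0 ≡ᵇ_) suc (upTo k)) (cong (map suc) (filterᵇ-none (upTo k) λ _ ())))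
  count (suc a) (s<s a<k) = trans (cong length (filterᵇ-map (suc a ≡ᵇ_) suc (upTo k)))
    (trans (length-map suc (filterᵇ (a ≡ᵇ_) (upTo k))) (count-upTo a<k))

eqList-sound : ∀ u v → True (eqList u v) → u ≡ v
eqList-sound [] [] _ = refl
eqList-sound (x ∷ u) (y ∷ v) h =
  let x≡y , u≡v = ∧-elim h in cong₂ _∷_ (≡ᵇ⇒≡ x y x≡y) (eqList-sound u v u≡v)

eqList-refl : ∀ u → True (eqList u u)
eqList-refl [] = _
eqList-refl (x ∷ u) = ∧-intro (≡⇒≡ᵇ x x refl) (eqList-refl u)

rotate-map : (f : ℕ → ℕ) (i : ℕ) (w : List ℕ) → rotate i (map f w) ≡ map f (rotate i w)
rotate-map f i w = begin
  drop i (map f w) ++ take i (map f w)   ≡⟨ cong₂ _++_ (drop-map i w) (take-map i w) ⟩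
  map f (drop i w) ++ map f (take i w)   ≡⟨ map-++ f (drop i w) (take i w) ⟨
  map f (drop i w ++ take i w)           ∎
  where open ≡-Reasoning

length-rotate : ∀ i (w : List ℕ) → length (rotate i w) ≡ length w
length-rotate i w = begin
  length (drop i w ++ take i w)          ≡⟨ length-++ (drop i w) ⟩
  length (drop i w) + length (take i w)  ≡⟨ +-comm (length (drop i w)) _ ⟩
  length (take i w) + length (drop i w)  ≡⟨ length-++ (take i w) ⟨
  length (take i w ++ drop i w)          ≡⟨ cong length (take++drop≡id i w) ⟩
  length w                               ∎
  where open ≡-Reasoning

-- words k (suc m) and fillings k (a ∷ α) unfold to consAll suc … and consAll id ….
consAll : (A → B) → List A → List (List B) → List (List B)
consAll f as ls = concatMap (λ a → map (f a ∷_) ls) as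

All-consAll : {P : A → Set} {Q R : List B → Set} {f : A → B} {as : List A} {ls : List (List B)} →
  (∀ {a l} → P a → Q l → R (f a ∷ l)) → All P as → All Q ls → All R (consAll f as ls)
All-consAll step Pas Qls =
  All.concat⁺ (All.map⁺ (All.map (λ Pa → All.map⁺ (All.map (step Pa) Qls)) Pas))

length-consAll : (f : A → B) (as : List A) (ls : List (List B)) →
  length (consAll f as ls) ≡ length as * length ls
length-consAll f [] ls = refl
length-consAll f (a ∷ as) ls = trans (length-++ (map (f a ∷_) ls))
  (cong₂ _+_ (length-map (f a ∷_) ls) (length-consAll f as ls))

filterᵇ-consAll : {P : List B → Bool} {p : A → Bool} {q : List B → Bool} (f : A → B) →
  (∀ a l → P (f a ∷ l) ≡ p a ∧ q l) → (as : List A) (ls : List (List B)) →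
  filterᵇ P (consAll f as ls) ≡ consAll f (filterᵇ p as) (filterᵇ q ls)
filterᵇ-consAll f split [] ls = refl
filterᵇ-consAll {P = P} {p} {q} f split (a ∷ as) ls = begin
  filterᵇ P (map (f a ∷_) ls ++ consAll f as ls)
    ≡⟨ filter-++ (T? ∘ P) (map (f a ∷_) ls) (consAll f as ls) ⟩
  filterᵇ P (map (f a ∷_) ls) ++ filterᵇ P (consAll f as ls)
    ≡⟨ cong₂ _++_ (filterᵇ-map P (f a ∷_) ls) (filterᵇ-consAll f split as ls) ⟩
  map (f a ∷_) (filterᵇ (P ∘ (f a ∷_)) ls) ++ rest
    ≡⟨ cong (λ l → map (f a ∷_) l ++ rest) (filterᵇ-cong-∈ ls λ {l} _ → split a l) ⟩
  map (f a ∷_) (filterᵇ (λ l → p a ∧ q l) ls) ++ rest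
    ≡⟨ prefix ⟩
  consAll f (filterᵇ p (a ∷ as)) (filterᵇ q ls) ∎
  where
  open ≡-Reasoning
  rest = consAll f (filterᵇ p as) (filterᵇ q ls)
  prefix : map (f a ∷_) (filterᵇ (λ l → p a ∧ q l) ls) ++ rest ≡ consAll f (filterᵇ p (a ∷ as)) (filterᵇ q ls)
  prefix with p a
  ... | true  = refl
  ... | false = cong (λ l → map (f a ∷_) l ++ rest) (filterᵇ-none ls λ _ ())

count-consAll : {P : List B → Bool} {p : A → Bool} {q : List B → Bool} (f : A → B) →
  (∀ a l → P (f a ∷ l) ≡ p a ∧ q l) → (as : List A) (ls : List (List B)) →
  length (filterᵇ P (consAll f as ls)) ≡ length (filterᵇ p as) * length (filterᵇ q ls)
count-consAll {p = p} {q} f split as ls =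
  trans (cong length (filterᵇ-consAll f split as ls)) (length-consAll f (filterᵇ p as) (filterᵇ q ls))

consAll-map : {f : A → B} {h : A → A} {g : B → B} → (∀ a → f (h a) ≡ g (f a)) →
  (as : List A) (ls : List (List B)) →
  consAll f (map h as) (map (map g) ls) ≡ map (map g) (consAll f as ls)
consAll-map comm [] ls = refl
consAll-map {f = f} {h} {g} comm (a ∷ as) ls = begin
  map (f (h a) ∷_) (map (map g) ls) ++ consAll f (map h as) (map (map g) ls)
    ≡⟨ cong₂ _++_ row (consAll-map comm as ls) ⟩
  map (map g) (map (f a ∷_) ls) ++ map (map g) (consAll f as ls)
    ≡⟨ map-++ (map g) (map (f a ∷_) ls) (consAll f as ls) ⟨
  map (map g) (map (f a ∷_) ls ++ consAll f as ls) ∎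
  where
  open ≡-Reasoning
  row : map (f (h a) ∷_) (map (map g) ls) ≡ map (map g) (map (f a ∷_) ls)
  row = trans (sym (map-∘ ls)) (trans (map-cong (λ l → cong (_∷ map g l) (comm a)) ls) (map-∘ ls))

-- Words, fillings and compositions

InAlphabet : ℕ → ℕ → Set
InAlphabet k x = 0 < x × x ≤ k

words-valid : ∀ k m → All (λ w → length w ≡ m × All (InAlphabet k) w) (words k m)
words-valid k zero = (refl , []) ∷ []
words-valid k (suc m) = All-consAll extend letters (words-valid k m)
  where
  letters : All (InAlphabet k ∘ suc) (upTo k)
  letters = All.applyUpTo⁺₁ id k (λ i<k → z<s , i<k)
  extend : ∀ {a w} → InAlphabet k (suc a) → length w ≡ m × All (InAlphabet k) w →
    length (suc a ∷ w) ≡ suc m × All (InAlphabet k) (suc a ∷ w)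
  extend a∈ (len , w∈) = cong suc len , a∈ ∷ w∈

fillings-valid : ∀ k α → All (λ T → map length T ≡ α × All (All (InAlphabet k)) T) (fillings k α)
fillings-valid k [] = (refl , []) ∷ []
fillings-valid k (a ∷ α) = All-consAll extend (words-valid k a) (fillings-valid k α)
  where
  extend : ∀ {r T} → length r ≡ a × All (InAlphabet k) r → map length T ≡ α × All (All (InAlphabet k)) T →
    map length (r ∷ T) ≡ a ∷ α × All (All (InAlphabet k)) (r ∷ T)
  extend (len , r∈) (shape , T∈) = cong₂ _∷_ len shape , r∈ ∷ T∈

count-words : ∀ {k} w → All (InAlphabet k) w → length (filterᵇ (eqList w) (words k (length w))) ≡ 1
count-words [] [] = refl
count-words {k} (suc a ∷ w) ((_ , a<k) ∷ w∈) =
  trans (count-consAll suc (λ _ _ → refl) (upTo k) (words k (length w)))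
        (cong₂ _*_ (count-upTo a<k) (count-words w w∈))

count-words-length≢ : ∀ {k m} w → length w ≢ m → length (filterᵇ (eqList w) (words k m)) ≡ 0
count-words-length≢ {k} {m} w len≢ = cong length (filterᵇ-none (words k m) λ v∈ w≡v →
  len≢ (trans (cong length (eqList-sound w _ w≡v)) (proj₁ (All.lookup (words-valid k m) v∈))))

eqTableau : List (List ℕ) → List (List ℕ) → Bool
eqTableau []      []      = true
eqTableau (r ∷ T) (s ∷ U) = eqList r s ∧ eqTableau T U
eqTableau _       _       = false

eqTableau-sound : ∀ T U → True (eqTableau T U) → T ≡ U
eqTableau-sound []      []      _ = refl
eqTableau-sound (r ∷ T) (s ∷ U) h =
  let r≡s , T≡U = ∧-elim h in cong₂ _∷_ (eqList-sound r s r≡s) (eqTableau-sound T U T≡U)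

eqTableau-refl : ∀ T → True (eqTableau T T)
eqTableau-refl [] = _
eqTableau-refl (r ∷ T) = ∧-intro (eqList-refl r) (eqTableau-refl T)

count-fillings : ∀ {k} T → All (All (InAlphabet k)) T →
  length (filterᵇ (eqTableau T) (fillings k (map length T))) ≡ 1
count-fillings [] [] = refl
count-fillings {k} (r ∷ T) (r∈ ∷ T∈) =
  trans (count-consAll id (λ _ _ → refl) (words k (length r)) (fillings k (map length T)))
        (cong₂ _*_ (count-words r r∈) (count-fillings T T∈))

count-compositions : ∀ {n} β → β ⊨ n → length (filterᵇ (eqList β) (compositions n)) ≡ 1
count-compositions {n} β (β>0 , refl) = begin
  length (filterᵇ (eqList β) (filterᵇ (λ γ → sum γ ≡ᵇ n) candidates))
    ≡⟨ cong length (filterᵇ-filterᵇ candidates λ {γ} _ β≡γ →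
         ≡⇒≡ᵇ (sum γ) n (cong sum (sym (eqList-sound β γ β≡γ)))) ⟩
  length (filterᵇ (eqList β) candidates)
    ≡⟨ cong length (filterᵇ-concatMap (eqList β) (words n) (upTo (suc n))) ⟩
  length (concatMap (filterᵇ (eqList β) ∘ words n) (upTo (suc n)))
    ≡⟨ length-concatMap (filterᵇ (eqList β) ∘ words n) (upTo (suc n)) ⟩
  sum (map (length ∘ filterᵇ (eqList β) ∘ words n) (upTo (suc n)))
    ≡⟨ cong sum (map-cong count-of-length (upTo (suc n))) ⟩
  sum (map (λ m → if length β ≡ᵇ m then 1 else 0) (upTo (suc n)))
    ≡⟨ sum-map-if (length β ≡ᵇ_) 1 (upTo (suc n)) ⟩
  1 * length (filterᵇ (length β ≡ᵇ_) (upTo (suc n)))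
    ≡⟨ cong (1 *_) (count-upTo (s≤s (length≤sum β>0))) ⟩
  1 ∎
  where
  open ≡-Reasoning
  candidates = concatMap (words n) (upTo (suc n))
  β∈ : All (InAlphabet n) β
  β∈ = All.tabulate λ b∈ → All.lookup β>0 b∈ , ∈⇒≤sum b∈
  count-of-length : ∀ m → length (filterᵇ (eqList β) (words n m)) ≡ (if length β ≡ᵇ m then 1 else 0)
  count-of-length m with length β ≡ᵇ m in eq
  ... | true  = subst (λ m → length (filterᵇ (eqList β) (words n m)) ≡ 1)
                  (≡ᵇ⇒≡ (length β) m (subst True (sym eq) _)) (count-words β β∈)
  ... | false = count-words-length≢ β λ len≡ → subst True eq (≡⇒≡ᵇ (length β) m len≡)

-- Counting letters

occurrences : ℕ → List ℕ → ℕ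
occurrences v r = length (filterᵇ (_≡ᵇ v) r)

indicator : ℕ → ℕ → ℕ
indicator x v = if x ≡ᵇ v then 1 else 0

occurrences-∷ : ∀ v x r → occurrences v (x ∷ r) ≡ indicator x v + occurrences v r
occurrences-∷ v x r with x ≡ᵇ v
... | true  = refl
... | false = refl

occurrences≤length : ∀ v r → occurrences v r ≤ length r
occurrences≤length v r = length-filter (λ x → T? (x ≡ᵇ v)) r

occurrences≡length⇒replicate : ∀ v r → occurrences v r ≡ length r → r ≡ replicate (length r) v
occurrences≡length⇒replicate v []      _ = refl
occurrences≡length⇒replicate v (x ∷ r) h with x ≡ᵇ v in eq
... | true  = cong₂ _∷_ (≡ᵇ⇒≡ x v (subst True (sym eq) _)) (occurrences≡length⇒replicate v r (suc-injective h))
... | false = ⊥-elim (1+n≰n (subst (_≤ length r) h (occurrences≤length v r)))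

occurrences-absent : ∀ {v r} → All (_≢ v) r → occurrences v r ≡ 0
occurrences-absent {v} {r} r≢v =
  cong length (filterᵇ-none r λ x∈ x≡v → All.lookup r≢v x∈ (≡ᵇ⇒≡ _ v x≡v))

countIn-absent : ∀ {v T} → All (All (_≢ v)) T → countIn v T ≡ 0
countIn-absent []          = refl
countIn-absent (r≢v ∷ T≢v) = cong₂ _+_ (occurrences-absent r≢v) (countIn-absent T≢v)

occurrences-replicate : ∀ a v → occurrences v (replicate a v) ≡ a
occurrences-replicate zero    v = refl
occurrences-replicate (suc a) v with v ≡ᵇ v in eq
... | true  = cong suc (occurrences-replicate a v)
... | false = ⊥-elim (subst True eq (≡⇒≡ᵇ v v refl))

countIn-positive : ∀ {v r T} → v ∈ r → r ∈ T → 0 < countIn v T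
countIn-positive {v} {r} v∈r r∈T = <-≤-trans
  (filter-some (λ x → T? (x ≡ᵇ v)) (Any.map (λ { refl → ≡⇒≡ᵇ v v refl }) v∈r))
  (∈⇒≤sum (∈-map⁺ (occurrences v) r∈T))

sum-occurrences : ∀ k r → All (InAlphabet k) r → sum (map (λ i → occurrences (suc i) r) (upTo k)) ≡ length r
sum-occurrences k []          []               = sum-map-0 (upTo k)
sum-occurrences k (suc x ∷ r) ((_ , x<k) ∷ r∈) = begin
  sum (map (λ i → occurrences (suc i) (suc x ∷ r)) (upTo k))
    ≡⟨ cong sum (map-cong (λ i → occurrences-∷ (suc i) (suc x) r) (upTo k)) ⟩
  sum (map (λ i → indicator x i + occurrences (suc i) r) (upTo k))
    ≡⟨ sum-map-+ (indicator x) (λ i → occurrences (suc i) r) (upTo k) ⟩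
  sum (map (indicator x) (upTo k)) + sum (map (λ i → occurrences (suc i) r) (upTo k))
    ≡⟨ cong₂ _+_ (trans (sum-map-if (x ≡ᵇ_) 1 (upTo k)) (trans (*-identityˡ _) (count-upTo x<k)))
                 (sum-occurrences k r r∈) ⟩
  suc (length r) ∎
  where open ≡-Reasoning

sum-content : ∀ k T → All (All (InAlphabet k)) T → sum (content k T) ≡ sum (map length T)
sum-content k []      []        = sum-map-0 (upTo k)
sum-content k (r ∷ T) (r∈ ∷ T∈) =
  trans (sum-map-+ (λ i → occurrences (suc i) r) (λ i → countIn (suc i) T) (upTo k))
        (cong₂ _+_ (sum-occurrences k r r∈) (sum-content k T T∈))

lexicalOfContent : List ℕ → List (List ℕ) → Bool
lexicalOfContent γ T = isLexical T ∧ eqList (content (length γ) T) γ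

countLexical-size≢ : ∀ {n} α γ → sum α ≡ n → sum γ ≢ n → countLexical α γ ≡ 0
countLexical-size≢ {n} α γ sumα≡n sumγ≢n =
  cong length (filterᵇ-none (fillings (length γ) α) λ T∈ h → sumγ≢n (sum-content≡n T∈ h))
  where
  open ≡-Reasoning
  sum-content≡n : ∀ {T} → T ∈ fillings (length γ) α → True (lexicalOfContent γ T) → sum γ ≡ n
  sum-content≡n {T} T∈ h = begin
    sum γ                       ≡⟨ cong sum (eqList-sound (content (length γ) T) γ (proj₂ (∧-elim {isLexical T} h))) ⟨
    sum (content (length γ) T)  ≡⟨ sum-content (length γ) T (proj₂ (All.lookup (fillings-valid (length γ) α) T∈)) ⟩
    sum (map length T)          ≡⟨ cong sum (proj₁ (All.lookup (fillings-valid (length γ) α) T∈)) ⟩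
    sum α                       ≡⟨ sumα≡n ⟩
    n                           ∎

-- Relabelling a tableau along the support of its content

module StrictlyMonotone {f : ℕ → ℕ} (f-mono : f Preserves _<_ ⟶ _<_) where

  reflects-< : ∀ {x y} → f x < f y → x < y
  reflects-< {x} {y} fx<fy with <-cmp x y
  ... | tri< x<y _ _  = x<y
  ... | tri≈ _ refl _ = ⊥-elim (<-irrefl refl fx<fy)
  ... | tri> _ _ y<x  = ⊥-elim (<-asym fx<fy (f-mono y<x))

  injective : ∀ {x y} → f x ≡ f y → x ≡ y
  injective {x} {y} fx≡fy with <-cmp x y
  ... | tri< x<y _ _ = ⊥-elim (<-irrefl fx≡fy (f-mono x<y))
  ... | tri≈ _ x≡y _ = x≡y
  ... | tri> _ _ y<x = ⊥-elim (<-irrefl (sym fx≡fy) (f-mono y<x))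

  <ᵇ-map : ∀ x y → (f x <ᵇ f y) ≡ (x <ᵇ y)
  <ᵇ-map x y = True-injective (<⇒<ᵇ ∘ reflects-< ∘ <ᵇ⇒< (f x) (f y)) (<⇒<ᵇ ∘ f-mono ∘ <ᵇ⇒< x y)

  ≡ᵇ-map : ∀ x y → (f x ≡ᵇ f y) ≡ (x ≡ᵇ y)
  ≡ᵇ-map x y = True-injective (≡⇒≡ᵇ x y ∘ injective ∘ ≡ᵇ⇒≡ (f x) (f y))
                              (≡⇒≡ᵇ (f x) (f y) ∘ cong f ∘ ≡ᵇ⇒≡ x y)

  lexLeq-map : ∀ u v → lexLeq (map f u) (map f v) ≡ lexLeq u v
  lexLeq-map []      v       = refl
  lexLeq-map (x ∷ u) []      = refl
  lexLeq-map (x ∷ u) (y ∷ v) = cong₂ _∨_ (<ᵇ-map x y) (cong₂ _∧_ (≡ᵇ-map x y) (lexLeq-map u v))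

  isNecklace-map : ∀ w → isNecklace (map f w) ≡ isNecklace w
  isNecklace-map w = trans
    (cong (λ n → allᵇ (λ i → lexLeq (map f w) (rotate i (map f w))) (upTo n)) (length-map f w))
    (allᵇ-cong (λ i → trans (cong (lexLeq (map f w)) (rotate-map f i w)) (lexLeq-map w (rotate i w)))
               (upTo (length w)))

  firstColIncreasing-map : ∀ T → firstColIncreasing (map (map f) T) ≡ firstColIncreasing T
  firstColIncreasing-map []                        = refl
  firstColIncreasing-map (r ∷ [])                  = refl
  firstColIncreasing-map ([] ∷ _ ∷ _)              = refl
  firstColIncreasing-map ((a ∷ r) ∷ [] ∷ _)        = refl
  firstColIncreasing-map ((a ∷ r) ∷ (b ∷ s) ∷ T) =
    cong₂ _∧_ (<ᵇ-map a b) (firstColIncreasing-map ((b ∷ s) ∷ T))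

  allNecklaces-map : ∀ T → allᵇ isNecklace (map (map f) T) ≡ allᵇ isNecklace T
  allNecklaces-map []      = refl
  allNecklaces-map (r ∷ T) = cong₂ _∧_ (isNecklace-map r) (allNecklaces-map T)

  isLexical-map : ∀ T → isLexical (map (map f) T) ≡ isLexical T
  isLexical-map T = cong₂ _∧_ (firstColIncreasing-map T) (allNecklaces-map T)

-- The position (from 0) of the (i+1)-st nonzero entry of γ; past the last one it continues
-- beyond the end of γ, so that it is strictly increasing on all of ℕ.
supportPosition : List ℕ → ℕ → ℕ
supportPosition []          i       = i
supportPosition (zero ∷ γ)  i       = suc (supportPosition γ i)
supportPosition (suc _ ∷ γ) zero    = zero
supportPosition (suc _ ∷ γ) (suc i) = suc (supportPosition γ i)

relabel : List ℕ → ℕ → ℕ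
relabel γ zero    = zero
relabel γ (suc i) = suc (supportPosition γ i)

inSupport : List ℕ → ℕ → Bool
inSupport []          _       = true
inSupport (zero ∷ γ)  zero    = false
inSupport (zero ∷ γ)  (suc i) = inSupport γ i
inSupport (suc _ ∷ γ) zero    = true
inSupport (suc _ ∷ γ) (suc i) = inSupport γ i

letterInSupport : List ℕ → ℕ → Bool
letterInSupport γ zero    = false
letterInSupport γ (suc i) = inSupport γ i

supportPosition-strictMono : ∀ γ → supportPosition γ Preserves _<_ ⟶ _<_
supportPosition-strictMono []          i<j       = i<j
supportPosition-strictMono (zero ∷ γ)  i<j       = s<s (supportPosition-strictMono γ i<j)
supportPosition-strictMono (suc _ ∷ γ) {zero}  {suc j} _         = z<s
supportPosition-strictMono (suc _ ∷ γ) {suc i} {suc j} (s<s i<j) = s<s (supportPosition-strictMono γ i<j)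

relabel-strictMono : ∀ γ → relabel γ Preserves _<_ ⟶ _<_
relabel-strictMono γ {zero}  {suc j} _         = z<s
relabel-strictMono γ {suc i} {suc j} (s<s i<j) = s<s (supportPosition-strictMono γ i<j)

support-upTo : ∀ γ →
  filterᵇ (inSupport γ) (upTo (length γ)) ≡ map (supportPosition γ) (upTo (length (nonzeros γ)))
support-upTo [] = refl
support-upTo (zero ∷ γ) = begin
  filterᵇ (inSupport (zero ∷ γ)) (upTo (suc (length γ)))
    ≡⟨ cong (filterᵇ (inSupport (zero ∷ γ))) (upTo-suc (length γ)) ⟩
  filterᵇ (inSupport (zero ∷ γ)) (map suc (upTo (length γ)))
    ≡⟨ filterᵇ-map (inSupport (zero ∷ γ)) suc (upTo (length γ)) ⟩
  map suc (filterᵇ (inSupport γ) (upTo (length γ)))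
    ≡⟨ cong (map suc) (support-upTo γ) ⟩
  map suc (map (supportPosition γ) (upTo (length (nonzeros γ))))
    ≡⟨ map-∘ (upTo (length (nonzeros γ))) ⟨
  map (supportPosition (zero ∷ γ)) (upTo (length (nonzeros γ))) ∎
  where open ≡-Reasoning
support-upTo (suc x ∷ γ) = begin
  filterᵇ (inSupport (suc x ∷ γ)) (upTo (suc (length γ)))
    ≡⟨ cong (filterᵇ (inSupport (suc x ∷ γ))) (upTo-suc (length γ)) ⟩
  0 ∷ filterᵇ (inSupport (suc x ∷ γ)) (map suc (upTo (length γ)))
    ≡⟨ cong (0 ∷_) (filterᵇ-map (inSupport (suc x ∷ γ)) suc (upTo (length γ))) ⟩
  0 ∷ map suc (filterᵇ (inSupport γ) (upTo (length γ)))
    ≡⟨ cong (λ l → 0 ∷ map suc l) (support-upTo γ) ⟩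
  0 ∷ map suc (map (supportPosition γ) (upTo k⁺))
    ≡⟨ cong (0 ∷_) (trans (sym (map-∘ (upTo k⁺))) (map-∘ (upTo k⁺))) ⟩
  0 ∷ map (supportPosition (suc x ∷ γ)) (map suc (upTo k⁺))
    ≡⟨ cong (map (supportPosition (suc x ∷ γ))) (upTo-suc k⁺) ⟨
  map (supportPosition (suc x ∷ γ)) (upTo (suc k⁺)) ∎
  where
  open ≡-Reasoning
  k⁺ = length (nonzeros γ)

words-onSupport : ∀ γ m → filterᵇ (allᵇ (letterInSupport γ)) (words (length γ) m)
                        ≡ map (map (relabel γ)) (words (length (nonzeros γ)) m)
words-onSupport γ zero    = refl
words-onSupport γ (suc m) = begin
  filterᵇ (allᵇ (letterInSupport γ)) (consAll suc (upTo k) (words k m))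
    ≡⟨ filterᵇ-consAll suc (λ _ _ → refl) (upTo k) (words k m) ⟩
  consAll suc (filterᵇ (inSupport γ) (upTo k)) (filterᵇ (allᵇ (letterInSupport γ)) (words k m))
    ≡⟨ cong₂ (consAll suc) (support-upTo γ) (words-onSupport γ m) ⟩
  consAll suc (map (supportPosition γ) (upTo k⁺)) (map (map (relabel γ)) (words k⁺ m))
    ≡⟨ consAll-map (λ _ → refl) (upTo k⁺) (words k⁺ m) ⟩
  map (map (relabel γ)) (consAll suc (upTo k⁺) (words k⁺ m)) ∎
  where
  open ≡-Reasoning
  k  = length γ
  k⁺ = length (nonzeros γ)

fillings-onSupport : ∀ γ α → filterᵇ (allᵇ (allᵇ (letterInSupport γ))) (fillings (length γ) α)
                           ≡ map (map (map (relabel γ))) (fillings (length (nonzeros γ)) α)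
fillings-onSupport γ []      = refl
fillings-onSupport γ (a ∷ α) = begin
  filterᵇ (allᵇ (allᵇ (letterInSupport γ))) (consAll id (words k a) (fillings k α))
    ≡⟨ filterᵇ-consAll id (λ _ _ → refl) (words k a) (fillings k α) ⟩
  consAll id (filterᵇ (allᵇ (letterInSupport γ)) (words k a))
             (filterᵇ (allᵇ (allᵇ (letterInSupport γ))) (fillings k α))
    ≡⟨ cong₂ (consAll id) (words-onSupport γ a) (fillings-onSupport γ α) ⟩
  consAll id (map (map (relabel γ)) (words k⁺ a)) (map (map (map (relabel γ))) (fillings k⁺ α))
    ≡⟨ consAll-map (λ _ → refl) (words k⁺ a) (fillings k⁺ α) ⟩
  map (map (map (relabel γ))) (consAll id (words k⁺ a) (fillings k⁺ α)) ∎
  where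
  open ≡-Reasoning
  k  = length γ
  k⁺ = length (nonzeros γ)

-- Puts N i at the position of the (i+1)-st nonzero entry of γ and 0 at its zero entries:
-- it turns the content of T into the content of its relabelling.
alongSupport : List ℕ → (ℕ → ℕ) → ℕ → ℕ
alongSupport []          N j       = N j
alongSupport (zero ∷ γ)  N zero    = 0
alongSupport (zero ∷ γ)  N (suc j) = alongSupport γ N j
alongSupport (suc _ ∷ γ) N zero    = N 0
alongSupport (suc _ ∷ γ) N (suc j) = alongSupport γ (N ∘ suc) j

alongSupport-cong : ∀ γ {M N : ℕ → ℕ} → (∀ i → M i ≡ N i) → ∀ j → alongSupport γ M j ≡ alongSupport γ N j
alongSupport-cong []          M≡N j       = M≡N j
alongSupport-cong (zero ∷ γ)  M≡N zero    = refl
alongSupport-cong (zero ∷ γ)  M≡N (suc j) = alongSupport-cong γ M≡N j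
alongSupport-cong (suc _ ∷ γ) M≡N zero    = M≡N 0
alongSupport-cong (suc _ ∷ γ) M≡N (suc j) = alongSupport-cong γ (M≡N ∘ suc) j

alongSupport-+ : ∀ γ (M N : ℕ → ℕ) j →
  alongSupport γ (λ i → M i + N i) j ≡ alongSupport γ M j + alongSupport γ N j
alongSupport-+ []          M N j       = refl
alongSupport-+ (zero ∷ γ)  M N zero    = refl
alongSupport-+ (zero ∷ γ)  M N (suc j) = alongSupport-+ γ M N j
alongSupport-+ (suc _ ∷ γ) M N zero    = refl
alongSupport-+ (suc _ ∷ γ) M N (suc j) = alongSupport-+ γ (M ∘ suc) (N ∘ suc) j

alongSupport-0 : ∀ γ j → alongSupport γ (λ _ → 0) j ≡ 0
alongSupport-0 []          j       = refl
alongSupport-0 (zero ∷ γ)  zero    = refl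
alongSupport-0 (zero ∷ γ)  (suc j) = alongSupport-0 γ j
alongSupport-0 (suc _ ∷ γ) zero    = refl
alongSupport-0 (suc _ ∷ γ) (suc j) = alongSupport-0 γ j

alongSupport-indicator : ∀ γ i j → indicator (supportPosition γ i) j ≡ alongSupport γ (indicator i) j
alongSupport-indicator []          i       j       = refl
alongSupport-indicator (zero ∷ γ)  i       zero    = refl
alongSupport-indicator (zero ∷ γ)  i       (suc j) = alongSupport-indicator γ i j
alongSupport-indicator (suc _ ∷ γ) zero    zero    = refl
alongSupport-indicator (suc _ ∷ γ) zero    (suc j) = sym (alongSupport-0 γ j)
alongSupport-indicator (suc _ ∷ γ) (suc i) zero    = refl
alongSupport-indicator (suc _ ∷ γ) (suc i) (suc j) = alongSupport-indicator γ i j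

occurrences-relabel : ∀ γ {r} → All (0 <_) r → ∀ j →
  occurrences (suc j) (map (relabel γ) r) ≡ alongSupport γ (λ i → occurrences (suc i) r) j
occurrences-relabel γ [] j = sym (alongSupport-0 γ j)
occurrences-relabel γ {suc i₀ ∷ r} (_ ∷ r>0) j = begin
  occurrences (suc j) (suc (supportPosition γ i₀) ∷ map (relabel γ) r)
    ≡⟨ occurrences-∷ (suc j) (suc (supportPosition γ i₀)) (map (relabel γ) r) ⟩
  indicator (supportPosition γ i₀) j + occurrences (suc j) (map (relabel γ) r)
    ≡⟨ cong₂ _+_ (alongSupport-indicator γ i₀ j) (occurrences-relabel γ r>0 j) ⟩
  alongSupport γ (indicator i₀) j + alongSupport γ (λ i → occurrences (suc i) r) j
    ≡⟨ alongSupport-+ γ (indicator i₀) (λ i → occurrences (suc i) r) j ⟨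
  alongSupport γ (λ i → indicator i₀ i + occurrences (suc i) r) j
    ≡⟨ alongSupport-cong γ (λ i → sym (occurrences-∷ (suc i) (suc i₀) r)) j ⟩
  alongSupport γ (λ i → occurrences (suc i) (suc i₀ ∷ r)) j ∎
  where open ≡-Reasoning

countIn-relabel : ∀ γ {T} → All (All (0 <_)) T → ∀ j →
  countIn (suc j) (map (map (relabel γ)) T) ≡ alongSupport γ (λ i → countIn (suc i) T) j
countIn-relabel γ [] j = sym (alongSupport-0 γ j)
countIn-relabel γ {r ∷ T} (r>0 ∷ T>0) j =
  trans (cong₂ _+_ (occurrences-relabel γ r>0 j) (countIn-relabel γ T>0 j))
        (sym (alongSupport-+ γ (λ i → occurrences (suc i) r) (λ i → countIn (suc i) T) j))

eqList-alongSupport : ∀ γ N → eqList (applyUpTo (alongSupport γ N) (length γ)) γ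
                            ≡ eqList (applyUpTo N (length (nonzeros γ))) (nonzeros γ)
eqList-alongSupport []          N = refl
eqList-alongSupport (zero ∷ γ)  N = eqList-alongSupport γ N
eqList-alongSupport (suc x ∷ γ) N = cong ((N 0 ≡ᵇ suc x) ∧_) (eqList-alongSupport γ (N ∘ suc))

content-relabel : ∀ γ {T} → All (All (0 <_)) T →
  eqList (content (length γ) (map (map (relabel γ)) T)) γ ≡ eqList (content (length (nonzeros γ)) T) (nonzeros γ)
content-relabel γ {T} T>0 = begin
  eqList (map (λ j → countIn (suc j) (map (map (relabel γ)) T)) (upTo (length γ))) γ
    ≡⟨ cong (λ c → eqList c γ) (trans (map-cong (countIn-relabel γ T>0) (upTo (length γ))) (map-upTo _ (length γ))) ⟩
  eqList (applyUpTo (alongSupport γ counts) (length γ)) γ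
    ≡⟨ eqList-alongSupport γ counts ⟩
  eqList (applyUpTo counts (length (nonzeros γ))) (nonzeros γ)
    ≡⟨ cong (λ c → eqList c (nonzeros γ)) (map-upTo counts (length (nonzeros γ))) ⟨
  eqList (content (length (nonzeros γ)) T) (nonzeros γ) ∎
  where
  open ≡-Reasoning
  counts = λ i → countIn (suc i) T

lexicalOfContent-relabel : ∀ γ {T} → All (All (0 <_)) T →
  lexicalOfContent γ (map (map (relabel γ)) T) ≡ lexicalOfContent (nonzeros γ) T
lexicalOfContent-relabel γ {T} T>0 =
  cong₂ _∧_ (StrictlyMonotone.isLexical-map (relabel-strictMono γ) T) (content-relabel γ T>0)

inSupport-positive : ∀ γ N {j} → j < length γ → 0 < N j →
  True (eqList (applyUpTo N (length γ)) γ) → True (inSupport γ j)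
inSupport-positive (zero ∷ γ)  N {zero}  _         N₀>0 h =
  ⊥-elim (<-irrefl (sym (≡ᵇ⇒≡ (N 0) 0 (proj₁ (∧-elim h)))) N₀>0)
inSupport-positive (suc _ ∷ γ) N {zero}  _         _    _ = _
inSupport-positive (zero ∷ γ)  N {suc j} (s<s j<k) Nj>0 h = inSupport-positive γ (N ∘ suc) j<k Nj>0 (proj₂ (∧-elim h))
inSupport-positive (suc _ ∷ γ) N {suc j} (s<s j<k) Nj>0 h = inSupport-positive γ (N ∘ suc) j<k Nj>0 (proj₂ (∧-elim h))

lexicalOfContent⇒onSupport : ∀ γ {α T} → T ∈ fillings (length γ) α → True (lexicalOfContent γ T) →
  True (allᵇ (allᵇ (letterInSupport γ)) T)
lexicalOfContent⇒onSupport γ {α} {T} T∈ h = allᵇ-intro T λ r∈T → allᵇ-intro _ λ v∈r →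
  onSupport r∈T v∈r (All.lookup (All.lookup (proj₂ (All.lookup (fillings-valid (length γ) α) T∈)) r∈T) v∈r)
  where
  content≡γ : True (eqList (applyUpTo (λ i → countIn (suc i) T) (length γ)) γ)
  content≡γ = subst (λ c → True (eqList c γ)) (map-upTo _ (length γ)) (proj₂ (∧-elim h))
  onSupport : ∀ {r v} → r ∈ T → v ∈ r → InAlphabet (length γ) v → True (letterInSupport γ v)
  onSupport {v = suc j} r∈T v∈r (_ , j<k) =
    inSupport-positive γ (λ i → countIn (suc i) T) j<k (countIn-positive v∈r r∈T) content≡γ

countLexical-nonzeros : ∀ α γ → countLexical α γ ≡ countLexical α (nonzeros γ)
countLexical-nonzeros α γ = begin
  length (filterᵇ (lexicalOfContent γ) Fₖ)
    ≡⟨ cong length (filterᵇ-filterᵇ Fₖ (lexicalOfContent⇒onSupport γ {α})) ⟨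
  length (filterᵇ (lexicalOfContent γ) (filterᵇ (allᵇ (allᵇ (letterInSupport γ))) Fₖ))
    ≡⟨ cong (length ∘ filterᵇ (lexicalOfContent γ)) (fillings-onSupport γ α) ⟩
  length (filterᵇ (lexicalOfContent γ) (map relabelᵀ F⁺))
    ≡⟨ cong length (filterᵇ-map (lexicalOfContent γ) relabelᵀ F⁺) ⟩
  length (map relabelᵀ (filterᵇ (lexicalOfContent γ ∘ relabelᵀ) F⁺))
    ≡⟨ length-map relabelᵀ (filterᵇ (lexicalOfContent γ ∘ relabelᵀ) F⁺) ⟩
  length (filterᵇ (lexicalOfContent γ ∘ relabelᵀ) F⁺)
    ≡⟨ cong length (filterᵇ-cong-∈ F⁺ λ T∈ → lexicalOfContent-relabel γ (positive T∈)) ⟩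
  length (filterᵇ (lexicalOfContent (nonzeros γ)) F⁺) ∎
  where
  open ≡-Reasoning
  Fₖ = fillings (length γ) α
  F⁺ = fillings (length (nonzeros γ)) α
  relabelᵀ = map (map (relabel γ))
  positive : ∀ {T} → T ∈ F⁺ → All (All (0 <_)) T
  positive T∈ = All.map (All.map proj₁) (proj₂ (All.lookup (fillings-valid _ α) T∈))

-- Triangularity

lexLeq-head : ∀ {x y xs ys} → True (lexLeq (x ∷ xs) (y ∷ ys)) → x ≤ y
lexLeq-head {x} {y} h with x <ᵇ y in lt
... | true  = <⇒≤ (<ᵇ⇒< x y (subst True (sym lt) _))
... | false = ≤-reflexive (≡ᵇ⇒≡ x y (proj₁ (∧-elim h)))

necklace-head-≤ : ∀ x xs → True (isNecklace (x ∷ xs)) → All (x ≤_) xs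
necklace-head-≤ x xs neck = heads xs λ {i} i<n →
  x ∷ take i xs , allᵇ-elim (upTo (suc (length xs))) neck (∈-upTo⁺ (s<s i<n))
  where
  -- rotate (suc i) (x ∷ xs) reduces to drop i xs ++ x ∷ take i xs.
  heads : ∀ ys → (∀ {i} → i < length ys → ∃ λ zs → True (lexLeq (x ∷ xs) (drop i ys ++ zs))) → All (x ≤_) ys
  heads []       _ = []
  heads (y ∷ ys) h = lexLeq-head {xs = xs} (proj₂ (h z<s)) ∷ heads ys (h ∘ s<s)

firstColumn-bound : ∀ {x r T} → True (firstColIncreasing ((x ∷ r) ∷ T)) → True (allᵇ isNecklace T) →
  All (λ s → 0 < length s) T → All (All (x <_)) T
firstColumn-bound {T = []} _ _ [] = []
firstColumn-bound {x} {T = (y ∷ s) ∷ T} increasing necklaces (_ ∷ T≠[]) =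
  (x<y ∷ All.map (<-≤-trans x<y) (necklace-head-≤ y s neck-y))
  ∷ All.map (All.map (<-trans x<y)) (firstColumn-bound increasing′ necklaces′ T≠[])
  where
  x<y = <ᵇ⇒< x y (proj₁ (∧-elim increasing))
  increasing′ = proj₂ (∧-elim increasing)
  neck-y = proj₁ (∧-elim necklaces)
  necklaces′ = proj₂ (∧-elim necklaces)

isLexical-tail : ∀ r T → True (isLexical (r ∷ T)) → True (isLexical T)
isLexical-tail r T lex =
  let firstCol , necklaces = ∧-elim {firstColIncreasing (r ∷ T)} lex
  in ∧-intro (firstCol-tail r T firstCol) (proj₂ (∧-elim {isNecklace r} necklaces))
  where
  firstCol-tail : ∀ r T → True (firstColIncreasing (r ∷ T)) → True (firstColIncreasing T)
  firstCol-tail r       []              _ = _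
  firstCol-tail (x ∷ r) ((y ∷ s) ∷ T) h = proj₂ (∧-elim h)

contentFrom : ℕ → ℕ → List (List ℕ) → List ℕ
contentFrom v zero    T = []
contentFrom v (suc m) T = countIn v T ∷ contentFrom (suc v) m T

content-contentFrom : ∀ m T → content m T ≡ contentFrom 1 m T
content-contentFrom = shifted 1
  where
  shifted : ∀ v m T → map (λ i → countIn (v + i) T) (upTo m) ≡ contentFrom v m T
  shifted v zero    T = refl
  shifted v (suc m) T = begin
    map (λ i → countIn (v + i) T) (upTo (suc m))
      ≡⟨ cong (map (λ i → countIn (v + i) T)) (upTo-suc m) ⟩
    countIn (v + 0) T ∷ map (λ i → countIn (v + i) T) (map suc (upTo m))
      ≡⟨ cong₂ _∷_ (cong (λ w → countIn w T) (+-identityʳ v))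
                   (trans (sym (map-∘ (upTo m))) (map-cong (λ i → cong (λ w → countIn w T) (+-suc v i)) (upTo m))) ⟩
    countIn v T ∷ map (λ i → countIn (suc v + i) T) (upTo m)
      ≡⟨ cong (countIn v T ∷_) (shifted (suc v) m T) ⟩
    contentFrom v (suc m) T ∎
    where open ≡-Reasoning

contentFrom-below : ∀ {v r} m T → All (_< v) r → contentFrom v m (r ∷ T) ≡ contentFrom v m T
contentFrom-below zero    T r<v = refl
contentFrom-below {v} {r} (suc m) T r<v = cong₂ _∷_
  (cong (_+ countIn v T) (occurrences-absent (All.map <⇒≢ r<v)))
  (contentFrom-below m T (All.map m<n⇒m<1+n r<v))

canonicalTableau : ℕ → List ℕ → List (List ℕ)
canonicalTableau v []      = []
canonicalTableau v (a ∷ α) = replicate a v ∷ canonicalTableau (suc v) α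

lexical-triangular : ∀ {v T β} → All (λ r → 0 < length r) T → All (All (v ≤_)) T → True (isLexical T) →
  All (0 <_) β → contentFrom v (length β) T ≡ β →
  ¬ (map length T <lex β) × (map length T ≡ β → T ≡ canonicalTableau v β)
lexical-triangular {T = []}    {[]}    _ _ _ _ _ = (λ { (base ()) }) , λ _ → refl
lexical-triangular {T = []}    {b ∷ β} _ _ _ (b>0 ∷ _) content≡ = ⊥-elim (<-irrefl (∷-injectiveˡ content≡) b>0)
lexical-triangular {T = _ ∷ _} {[]}    _ _ _ _ _ = (λ ()) , (λ ())
lexical-triangular {v} {(x ∷ r) ∷ T} {b ∷ β} (_ ∷ T≠[]) ((v≤x ∷ _) ∷ _) lex (_ ∷ β>0) content≡ =
  shorter , equal
  where
  row = x ∷ r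
  firstCol = proj₁ (∧-elim {firstColIncreasing (row ∷ T)} lex)
  necklaces = proj₂ (∧-elim {isNecklace row} (proj₂ (∧-elim {firstColIncreasing (row ∷ T)} lex)))
  T>x : All (All (x <_)) T
  T>x = firstColumn-bound firstCol necklaces T≠[]
  T≢v : All (All (_≢ v)) T
  T≢v = All.map (All.map λ x<y → >⇒≢ (≤-<-trans v≤x x<y)) T>x
  row-count : occurrences v row ≡ b
  row-count = begin
    occurrences v row                 ≡⟨ +-identityʳ _ ⟨
    occurrences v row + 0             ≡⟨ cong (occurrences v row +_) (countIn-absent T≢v) ⟨
    countIn v (row ∷ T)               ≡⟨ ∷-injectiveˡ content≡ ⟩
    b                                 ∎
    where open ≡-Reasoning
  b≤len : b ≤ length row
  b≤len = subst (_≤ length row) row-count (occurrences≤length v row)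
  rest : length row ≡ b → row ≡ replicate b v ×
    (¬ (map length T <lex β) × (map length T ≡ β → T ≡ canonicalTableau (suc v) β))
  rest len≡b = trans row≡ (cong (λ n → replicate n v) len≡b) ,
    lexical-triangular T≠[] T>v (isLexical-tail row T lex) β>0 content′
    where
    row≡ : row ≡ replicate (length row) v
    row≡ = occurrences≡length⇒replicate v row (trans row-count (sym len≡b))
    T>v : All (All (suc v ≤_)) T
    T>v = subst (λ y → All (All (y <_)) T) (∷-injectiveˡ row≡) T>x
    content′ : contentFrom (suc v) (length β) T ≡ β
    content′ = trans (sym (contentFrom-below (length β) T
                 (subst (All (_< suc v)) (sym row≡) (All.replicate⁺ (length row) (n<1+n v)))))
               (∷-injectiveʳ content≡)
  shorter : ¬ ((length row ∷ map length T) <lex (b ∷ β))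
  shorter (this len<b)        = <⇒≱ len<b b≤len
  shorter (next len≡b shape<) = proj₁ (proj₂ (rest len≡b)) shape<
  equal : length row ∷ map length T ≡ b ∷ β → row ∷ T ≡ replicate b v ∷ canonicalTableau (suc v) β
  equal eq = let len≡b , shape≡ = ∷-injective eq
             in cong₂ _∷_ (proj₁ (rest len≡b)) (proj₂ (proj₂ (rest len≡b)) shape≡)

canonicalTableau-shape : ∀ v α → map length (canonicalTableau v α) ≡ α
canonicalTableau-shape v []      = refl
canonicalTableau-shape v (a ∷ α) = cong₂ _∷_ (length-replicate a) (canonicalTableau-shape (suc v) α)

canonicalTableau-range : ∀ v α → All (All (λ x → v ≤ x × x < v + length α)) (canonicalTableau v α)
canonicalTableau-range v []      = []
canonicalTableau-range v (a ∷ α) =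
  All.replicate⁺ a (≤-refl , subst (v <_) (sym (+-suc v (length α))) (s≤s (m≤m+n v (length α))))
  ∷ All.map (All.map λ {x} (v<x , x<) → <⇒≤ v<x , subst (x <_) (sym (+-suc v (length α))) x<)
            (canonicalTableau-range (suc v) α)

canonicalTableau-content : ∀ v α → contentFrom v (length α) (canonicalTableau v α) ≡ α
canonicalTableau-content v []      = refl
canonicalTableau-content v (a ∷ α) = cong₂ _∷_ first-row other-rows
  where
  C = canonicalTableau (suc v) α
  first-row : occurrences v (replicate a v) + countIn v C ≡ a
  first-row = trans (cong₂ _+_ (occurrences-replicate a v)
                      (countIn-absent (All.map (All.map λ (v<x , _) → >⇒≢ v<x) (canonicalTableau-range (suc v) α))))
                    (+-identityʳ a)
  other-rows : contentFrom (suc v) (length α) (replicate a v ∷ C) ≡ α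
  other-rows = trans (contentFrom-below (length α) C (All.replicate⁺ a (n<1+n v))) (canonicalTableau-content (suc v) α)

lexLeq-replicate : ∀ a {v w} → a ≤ length w → All (_≡ v) w → True (lexLeq (replicate a v) w)
lexLeq-replicate zero    _         _           = _
lexLeq-replicate (suc a) {v} (s≤s a≤) (refl ∷ w≡v) =
  Equivalence.from T-∨ (inj₂ (∧-intro (≡⇒≡ᵇ v v refl) (lexLeq-replicate a a≤ w≡v)))

replicate-necklace : ∀ a v → True (isNecklace (replicate a v))
replicate-necklace a v = allᵇ-intro (upTo (length w)) λ {i} _ →
  lexLeq-replicate a (≤-reflexive (trans (sym (length-replicate a)) (sym (length-rotate i w))))
    (All.++⁺ (All.drop⁺ i w≡v) (All.take⁺ i w≡v))
  where
  w = replicate a v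
  w≡v = All.replicate⁺ a refl

canonicalTableau-lexical : ∀ v α → All (0 <_) α → True (isLexical (canonicalTableau v α))
canonicalTableau-lexical v α α>0 = ∧-intro (firstCol v α α>0) (necklaces v α)
  where
  firstCol : ∀ v α → All (0 <_) α → True (firstColIncreasing (canonicalTableau v α))
  firstCol v []                  _                   = _
  firstCol v (a ∷ [])            _                   = _
  firstCol v (suc a ∷ suc b ∷ α) (_ ∷ b>0 ∷ α>0) =
    ∧-intro (<⇒<ᵇ (n<1+n v)) (firstCol (suc v) (suc b ∷ α) (b>0 ∷ α>0))
  necklaces : ∀ v α → True (allᵇ isNecklace (canonicalTableau v α))
  necklaces v []      = _
  necklaces v (a ∷ α) = ∧-intro (replicate-necklace a v) (necklaces (suc v) α)

lexicalFilling-triangular : ∀ {α β T} → All (0 <_) α → All (0 <_) β → T ∈ fillings (length β) α →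
  True (lexicalOfContent β T) → ¬ (α <lex β) × (α ≡ β → T ≡ canonicalTableau 1 β)
lexicalFilling-triangular {α} {β} {T} α>0 β>0 T∈ h =
  subst (λ α → ¬ (α <lex β) × (α ≡ β → T ≡ canonicalTableau 1 β)) shape
    (lexical-triangular nonempty (All.map (All.map proj₁) T∈k) lexical β>0 content≡)
  where
  shape = proj₁ (All.lookup (fillings-valid (length β) α) T∈)
  T∈k = proj₂ (All.lookup (fillings-valid (length β) α) T∈)
  lexical = proj₁ (∧-elim {isLexical T} h)
  nonempty : All (λ r → 0 < length r) T
  nonempty = All.map⁻ (subst (All (0 <_)) (sym shape) α>0)
  content≡ : contentFrom 1 (length β) T ≡ β
  content≡ = trans (sym (content-contentFrom (length β) T)) (eqList-sound _ β (proj₂ (∧-elim {isLexical T} h)))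

countLexical-diagonal : ∀ α → All (0 <_) α → countLexical α α ≡ 1
countLexical-diagonal α α>0 = begin
  length (filterᵇ (lexicalOfContent α) F)
    ≡⟨ cong length (filterᵇ-cong-∈ F λ T∈ → True-injective (lexical⇒canonical T∈) (canonical⇒lexical _)) ⟩
  length (filterᵇ (eqTableau C) F)
    ≡⟨ cong (λ β → length (filterᵇ (eqTableau C) (fillings (length α) β))) (canonicalTableau-shape 1 α) ⟨
  length (filterᵇ (eqTableau C) (fillings (length α) (map length C)))
    ≡⟨ count-fillings C C∈ ⟩
  1 ∎
  where
  open ≡-Reasoning
  C = canonicalTableau 1 α
  F = fillings (length α) α
  C∈ : All (All (InAlphabet (length α))) C
  C∈ = All.map (All.map λ (x>0 , x≤) → x>0 , s≤s⁻¹ x≤) (canonicalTableau-range 1 α)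
  lexical⇒canonical : ∀ {T} → T ∈ F → True (lexicalOfContent α T) → True (eqTableau C T)
  lexical⇒canonical T∈ h =
    subst (True ∘ eqTableau C) (sym (proj₂ (lexicalFilling-triangular α>0 α>0 T∈ h) refl)) (eqTableau-refl C)
  C-lexical : True (lexicalOfContent α C)
  C-lexical = ∧-intro (canonicalTableau-lexical 1 α α>0)
    (subst (λ c → True (eqList c α))
           (sym (trans (content-contentFrom (length α) C) (canonicalTableau-content 1 α)))
           (eqList-refl α))
  canonical⇒lexical : ∀ T → True (eqTableau C T) → True (lexicalOfContent α T)
  canonical⇒lexical T h = subst (True ∘ lexicalOfContent α) (eqTableau-sound C T h) C-lexical

countLexical-upper : ∀ {α β} → All (0 <_) α → All (0 <_) β → α <lex β → countLexical α β ≡ 0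
countLexical-upper {α} {β} α>0 β>0 α<β = cong length (filterᵇ-none (fillings (length β) α) λ T∈ h →
  proj₁ (lexicalFilling-triangular α>0 β>0 T∈ h) α<β)

-- Coefficients in the monomial basis

nonzeros-positive : ∀ γ → All (0 <_) (nonzeros γ)
nonzeros-positive []          = []
nonzeros-positive (zero ∷ γ)  = nonzeros-positive γ
nonzeros-positive (suc _ ∷ γ) = z<s ∷ nonzeros-positive γ

coeffSumM-count : ∀ n c γ →
  coeffSumM n c γ ≡ c (nonzeros γ) * length (filterᵇ (eqList (nonzeros γ)) (compositions n))
coeffSumM-count n c γ =
  trans (cong sum (map-cong term (compositions n))) (sum-map-if (eqList γ⁺) (c γ⁺) (compositions n))
  where
  γ⁺ = nonzeros γ
  term : ∀ β → c β * coeffM β γ ≡ (if eqList γ⁺ β then c γ⁺ else 0)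
  term β with eqList γ⁺ β in eq
  ... | true  = trans (*-identityʳ (c β)) (cong c (sym (eqList-sound γ⁺ β (subst True (sym eq) _))))
  ... | false = *-zeroʳ (c β)

coeffSumM-composition : ∀ {n} c γ → sum (nonzeros γ) ≡ n → coeffSumM n c γ ≡ c (nonzeros γ)
coeffSumM-composition {n} c γ sum≡n = trans (coeffSumM-count n c γ)
  (trans (cong (c (nonzeros γ) *_) (count-compositions (nonzeros γ) (nonzeros-positive γ , sum≡n)))
         (*-identityʳ _))

coeffSumM-noncomposition : ∀ {n} c γ → sum (nonzeros γ) ≢ n → coeffSumM n c γ ≡ 0
coeffSumM-noncomposition {n} c γ sum≢n = trans (coeffSumM-count n c γ)
  (trans (cong (λ l → c (nonzeros γ) * length l) (filterᵇ-none (compositions n) not-listed))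
         (*-zeroʳ (c (nonzeros γ))))
  where
  not-listed : ∀ {β} → β ∈ compositions n → ¬ True (eqList (nonzeros γ) β)
  not-listed {β} β∈ γ⁺≡β = sum≢n (trans (cong sum (eqList-sound (nonzeros γ) β γ⁺≡β))
    (≡ᵇ⇒≡ (sum β) n (proj₂ (∈-filter⁻ (λ β → T? (sum β ≡ᵇ n)) {xs = concatMap (words n) (upTo (suc n))} β∈))))

theorem4p2 : (n : ℕ) (α : List ℕ) → α ⊨ n →
    ((γ : List ℕ) → coeffDualLexical α γ ≡ coeffSumM n (K α) γ)
    × (K α α ≡ 1)
    × ((β : List ℕ) → β ⊨ n → α <lex β → K α β ≡ 0)
theorem4p2 n α (α>0 , sumα≡n) = expansion , countLexical-diagonal α α>0 , λ β (β>0 , _) → countLexical-upper α>0 β>0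
  where
  expansion : (γ : List ℕ) → countLexical α γ ≡ coeffSumM n (K α) γ
  expansion γ with sum (nonzeros γ) ≟ n
  ... | yes sum≡n = trans (countLexical-nonzeros α γ) (sym (coeffSumM-composition (K α) γ sum≡n))
  ... | no  sum≢n = begin
    countLexical α γ            ≡⟨ countLexical-nonzeros α γ ⟩
    countLexical α (nonzeros γ) ≡⟨ countLexical-size≢ α (nonzeros γ) sumα≡n sum≢n ⟩
    0                           ≡⟨ coeffSumM-noncomposition (K α) γ sum≢n ⟨
    coeffSumM n (K α) γ         ∎
    where open ≡-Reasoning
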